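{- Let $\mathcal{F}$ be a finite set system with $\emptyset\notin\mathcal{F}$ such that for any two distinct sets $A,B\in\mathcal{F}$ there is at most one set in $\mathcal{F}$ that is disjoint from both $A$ and $B$. Then $\mathrm{cd}_2(\mathcal{F})\le 3$.
   Context: With $X=\bigcup\mathcal{F}$, the $2$-colorability defect is $\mathrm{cd}_2(\mathcal{F})=\min\{|Y|: Y\subseteq X,\ \text{the points of } X\setminus Y \text{ can be colored with 2 colors so that no } F\in\mathcal{F} \text{ with } F\cap Y=\emptyset \text{ is monochromatic}\}$. -}

module Defs where

open import Data.Nat using (ℕ; _≤_)
open import Data.Bool using (Bool)
open import Data.Fin using (Fin)
open import Data.Fin.Subset using (Subset; _∈_; _∉_; _⊆_; _∩_; ⋃; ∣_∣; Nonempty; Empty)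
open import Data.List using (List)
import Data.List.Membership.Propositional as LM
open import Data.Product using (_×_; ∃; ∃-syntax)
open import Relation.Nullary using (¬_)
open import Relation.Binary.PropositionalEquality using (_≡_; _≢_)

-- A finite set system over the ground type Fin n is a list of subsets;
-- membership of a set in the family is list membership (duplicates irrelevant).
Family : ℕ → Set
Family n = List (Subset n)

_∈F_ : ∀ {n} → Subset n → Family n → Set
A ∈F 𝓕 = A LM.∈ 𝓕

Disjoint : ∀ {n} → Subset n → Subset n → Set
Disjoint A B = Empty (A ∩ B)

Monochromatic : ∀ {n} → (Fin n → Bool) → Subset n → Set
Monochromatic c F = ∀ {x y} → x ∈ F → y ∈ F → c x ≡ c y

-- Y witnesses the 2-colourability defect: Y ⊆ X = ⋃𝓕 and the points can be
-- 2-coloured so that no F ∈ 𝓕 with F ∩ Y = ∅ is monochromatic.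
-- (Colours of points outside X ∖ Y are irrelevant for such F.)
DefectWitness : ∀ {n} → Family n → Subset n → Set
DefectWitness 𝓕 Y =
  (Y ⊆ ⋃ 𝓕) ×
  ∃[ c ] (∀ {F} → F ∈F 𝓕 → Disjoint F Y → ¬ Monochromatic c F)

cd₂≤ : ∀ {n} → Family n → ℕ → Set
cd₂≤ 𝓕 k = ∃[ Y ] (∣ Y ∣ ≤ k × DefectWitness 𝓕 Y)

{-# OPTIONS --safe #-}
module Submission where

-- Take A, B ∈ 𝓕 and p ∈ B ∖ A with ∣ A ∪ B ∣ minimal. Then every member S ≠ A
-- of 𝓕 inside A ∪ B contains p, for otherwise S and A would form a smaller such
-- pair. Colour A ∪ B red and the rest blue, and delete p, a point q ∈ A, and a
-- point of the unique member disjoint from A and B, if there is one. A member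
-- avoiding the deleted points can lie neither inside A ∪ B (it would be A or
-- contain p) nor outside it (it would be that unique member), so it is
-- bichromatic. If 𝓕 has no two distinct members, deleting one point suffices.

open import Defs
open import Data.Nat using (ℕ)
open import Data.Fin.Subset using (Subset; Nonempty)
open import Relation.Binary.PropositionalEquality using (_≡_; _≢_)

open import Data.Bool using (Bool)
import Data.Bool.Properties as Bool
open import Data.Empty using (⊥-elim)
open import Data.Fin using (Fin)
open import Data.Fin.Properties using (¬∀⟶∃¬)
open import Data.Fin.Subset using (_∈_; _∉_; _⊆_; _⊈_; _⊂_; _∩_; _∪_; ⋃; ∣_∣; ⁅_⁆; ⊥; inside; outside)
open import Data.Fin.Subset.Properties
  using (_∈?_; _⊆?_; nonempty?; ⊆-refl; ⊆-antisym; ⊆-⊂-trans; p⊂q⇒∣p∣<∣q∣;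
         p⊆p∪q; q⊆p∪q; x∈p∪q⁺; x∈p∪q⁻; x∈p∩q⁺; x∈p∩q⁻; x∈⁅x⁆; x∈⁅y⁆⇒x≡y; ∣⁅x⁆∣≡1; ∣⊥∣≡0; ∉⊥)
open import Data.List using (_∷_)
open import Data.List.Relation.Unary.Any using (here; there; any?)
open import Data.List.Membership.Propositional using (find; lose)
open import Data.Nat using (_+_; _≤_; _<_; z≤n; s≤s)
open import Data.Nat.Induction using (<-wellFounded)
open import Data.Nat.Properties using (≤-trans; ≤-reflexive; +-suc; +-mono-≤; +-monoʳ-≤; n≤1+n)
open import Data.Product using (Σ; Σ-syntax; ∃-syntax; _×_; _,_)
open import Data.Sum using (_⊎_; inj₁; inj₂; [_,_])
open import Data.Unit using (⊤; tt)
open import Data.Vec using ([]; _∷_)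
open import Data.Vec.Properties using (≡-dec)
open import Function using (_∘_; _on_)
open import Induction.WellFounded using (Acc; acc)
import Relation.Binary.Construct.On as On
open import Relation.Binary.Definitions using (DecidableEquality)
open import Relation.Binary.PropositionalEquality using (refl; sym; subst)
open import Relation.Nullary using (¬_; yes; no; does; ¬?; _×-dec_; _→-dec_)
open import Relation.Nullary.Decidable using (dec-true; dec-false; decidable-stable)
open import Relation.Unary using (Pred; Decidable)

module _ {n : ℕ} where

  _≟_ : DecidableEquality (Subset n)
  _≟_ = ≡-dec Bool._≟_

  ⊈⇒∃∉ : ∀ {p q : Subset n} → p ⊈ q → ∃[ x ] (x ∈ p × x ∉ q)
  ⊈⇒∃∉ {p} {q} p⊈q with ¬∀⟶∃¬ n _ (λ x → x ∈? p →-dec x ∈? q) (λ p⊆q → p⊈q (p⊆q _))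
  ... | x , x∈p⇏x∈q with x ∈? p
  ...   | yes x∈p = x , x∈p , λ x∈q → x∈p⇏x∈q (λ _ → x∈q)
  ...   | no x∉p = ⊥-elim (x∈p⇏x∈q (⊥-elim ∘ x∉p))

  ≢⇒∃∉ : ∀ {p q : Subset n} → p ≢ q → ∃[ x ] (x ∈ q × x ∉ p) ⊎ ∃[ x ] (x ∈ p × x ∉ q)
  ≢⇒∃∉ {p} {q} p≢q with p ⊆? q
  ... | yes p⊆q = inj₁ (⊈⇒∃∉ (p≢q ∘ ⊆-antisym p⊆q))
  ... | no p⊈q = inj₂ (⊈⇒∃∉ p⊈q)

  ∪-lub : ∀ {p q r : Subset n} → p ⊆ r → q ⊆ r → p ∪ q ⊆ r
  ∪-lub {p} {q} p⊆r q⊆r = [ p⊆r , q⊆r ] ∘ x∈p∪q⁻ p q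

  ⁅x⁆⊆p : ∀ {x} {p : Subset n} → x ∈ p → ⁅ x ⁆ ⊆ p
  ⁅x⁆⊆p {x} x∈p y∈⁅x⁆ = subst (_∈ _) (sym (x∈⁅y⁆⇒x≡y x y∈⁅x⁆)) x∈p

  ∈-colour-separates : ∀ (R : Subset n) {x y} → x ∈ R → y ∉ R → does (x ∈? R) ≢ does (y ∈? R)
  ∈-colour-separates R x∈R y∉R rewrite dec-true (_ ∈? R) x∈R | dec-false (_ ∈? R) y∉R = λ ()

  disjoint⇒∉ : ∀ {p q : Subset n} {x} → Disjoint p q → x ∈ p → x ∉ q
  disjoint⇒∉ p∩q≡∅ x∈p x∈q = p∩q≡∅ (_ , x∈p∩q⁺ (x∈p , x∈q))

  disjoint-antimonoʳ : ∀ {p q r : Subset n} → q ⊆ r → Disjoint p r → Disjoint p q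
  disjoint-antimonoʳ q⊆r p∩r≡∅ (x , x∈p∩q) with x∈p , x∈q ← x∈p∩q⁻ _ _ x∈p∩q =
    disjoint⇒∉ p∩r≡∅ x∈p (q⊆r x∈q)

∣p∪q∣≤∣p∣+∣q∣ : ∀ {n} (p q : Subset n) → ∣ p ∪ q ∣ ≤ ∣ p ∣ + ∣ q ∣
∣p∪q∣≤∣p∣+∣q∣ [] [] = z≤n
∣p∪q∣≤∣p∣+∣q∣ (inside ∷ p) (inside ∷ q) = s≤s (≤-trans (∣p∪q∣≤∣p∣+∣q∣ p q) (+-monoʳ-≤ ∣ p ∣ (n≤1+n ∣ q ∣)))
∣p∪q∣≤∣p∣+∣q∣ (inside ∷ p) (outside ∷ q) = s≤s (∣p∪q∣≤∣p∣+∣q∣ p q)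
∣p∪q∣≤∣p∣+∣q∣ (outside ∷ p) (inside ∷ q) rewrite +-suc ∣ p ∣ ∣ q ∣ = s≤s (∣p∪q∣≤∣p∣+∣q∣ p q)
∣p∪q∣≤∣p∣+∣q∣ (outside ∷ p) (outside ∷ q) = ∣p∪q∣≤∣p∣+∣q∣ p q

∈F⇒⊆⋃ : ∀ {n} {𝓕 : Family n} {S} → S ∈F 𝓕 → S ⊆ ⋃ 𝓕
∈F⇒⊆⋃ {𝓕 = T ∷ 𝓕} (here refl) = p⊆p∪q (⋃ 𝓕)
∈F⇒⊆⋃ {𝓕 = T ∷ 𝓕} (there S∈𝓕) = q⊆p∪q T (⋃ 𝓕) ∘ ∈F⇒⊆⋃ S∈𝓕

cd₂≤-mono : ∀ {n} {𝓕 : Family n} {k m} → k ≤ m → cd₂≤ 𝓕 k → cd₂≤ 𝓕 m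
cd₂≤-mono k≤m (Y , ∣Y∣≤k , witness) = Y , ≤-trans ∣Y∣≤k k≤m , witness

module _ {n : ℕ} (𝓕 : Family n) where

  record Separated : Set where
    constructor separated
    field
      A B : Subset n
      p : Fin n
      A∈𝓕 : A ∈F 𝓕
      B∈𝓕 : B ∈F 𝓕
      p∈B : p ∈ B
      p∉A : p ∉ A

    span : Subset n
    span = A ∪ B

  Pinned : Separated → Set
  Pinned s = ∀ {S} → S ∈F 𝓕 → S ≢ A → S ⊆ A ∪ B → p ∈ S
    where open Separated s

  separate : ∀ {A S} → A ∈F 𝓕 → S ∈F 𝓕 → S ≢ A → Σ[ s ∈ Separated ] (Separated.span s ⊆ A ∪ S)
  separate {A} {S} A∈𝓕 S∈𝓕 S≢A with ≢⇒∃∉ S≢A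
  ... | inj₁ (x , x∈A , x∉S) = separated S A x S∈𝓕 A∈𝓕 x∈A x∉S , ∪-lub (q⊆p∪q A S) (p⊆p∪q S)
  ... | inj₂ (x , x∈S , x∉A) = separated A S x A∈𝓕 S∈𝓕 x∈S x∉A , ⊆-refl

  _≺_ : Separated → Separated → Set
  _≺_ = _<_ on (∣_∣ ∘ Separated.span)

  pinned-or-shrinks : (s : Separated) → Pinned s ⊎ ∃[ s′ ] (s′ ≺ s)
  pinned-or-shrinks s
    with any? (λ S → ¬? (S ≟ A) ×-dec S ⊆? A ∪ B ×-dec ¬? (p ∈? S)) 𝓕
    where open Separated s
  ... | no ¬violated = inj₁ λ S∈𝓕 S≢A S⊆A∪B →
    decidable-stable (_ ∈? _) (λ p∉S → ¬violated (lose S∈𝓕 (S≢A , S⊆A∪B , p∉S)))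
  ... | yes violated
    with S , S∈𝓕 , S≢A , S⊆A∪B , p∉S ← find violated
    with s′ , span′⊆A∪S ← separate (Separated.A∈𝓕 s) S∈𝓕 S≢A
    = inj₂ (s′ , p⊂q⇒∣p∣<∣q∣ (⊆-⊂-trans span′⊆A∪S A∪S⊂A∪B))
    where
    open Separated s
    A∪S⊂A∪B : A ∪ S ⊂ A ∪ B
    A∪S⊂A∪B = ∪-lub (p⊆p∪q B) S⊆A∪B , p , x∈p∪q⁺ (inj₂ p∈B) , [ p∉A , p∉S ] ∘ x∈p∪q⁻ A S

  pinned-separated : Separated → Σ Separated Pinned
  pinned-separated s = go s (On.wellFounded (∣_∣ ∘ Separated.span) <-wellFounded s)
    where
    go : (s : Separated) → Acc _≺_ s → Σ Separated Pinned
    go s (acc smaller) with pinned-or-shrinks s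
    ... | inj₁ pinned = s , pinned
    ... | inj₂ (s′ , s′≺s) = go s′ (smaller s′≺s)

  unique⇒hitting-set≤1 : ∀ {ℓ} {P : Pred (Subset n) ℓ} → Decidable P →
    (∀ {A} → A ∈F 𝓕 → Nonempty A) →
    (∀ {C D} → C ∈F 𝓕 → D ∈F 𝓕 → P C → P D → C ≡ D) →
    ∃[ Z ] (∣ Z ∣ ≤ 1 × Z ⊆ ⋃ 𝓕 × (∀ {F} → F ∈F 𝓕 → P F → Nonempty (F ∩ Z)))
  unique⇒hitting-set≤1 P? nonempty unique with any? P? 𝓕
  ... | no ¬∃P = ⊥ , ≤-trans (≤-reflexive (∣⊥∣≡0 n)) z≤n , ⊥-elim ∘ ∉⊥ ,
    λ F∈𝓕 PF → ⊥-elim (¬∃P (lose F∈𝓕 PF))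
  ... | yes ∃P
    with C , C∈𝓕 , PC ← find ∃P
    with z , z∈C ← nonempty C∈𝓕
    = ⁅ z ⁆ , ≤-reflexive (∣⁅x⁆∣≡1 z) , ⁅x⁆⊆p (∈F⇒⊆⋃ C∈𝓕 z∈C) ,
      λ F∈𝓕 PF → z , x∈p∩q⁺ (subst (z ∈_) (unique C∈𝓕 F∈𝓕 PC PF) z∈C , x∈⁅x⁆ z)

  Straddles : Subset n → Subset n → Set
  Straddles R F = Nonempty (F ∩ R) × F ⊈ R

  straddling⇒DefectWitness : ∀ R {Y} → Y ⊆ ⋃ 𝓕 →
    (∀ {F} → F ∈F 𝓕 → Disjoint F Y → Straddles R F) → DefectWitness 𝓕 Y
  straddling⇒DefectWitness R Y⊆⋃𝓕 straddles = Y⊆⋃𝓕 , colour , bichromatic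
    where
    colour : Fin n → Bool
    colour x = does (x ∈? R)

    bichromatic : ∀ {F} → F ∈F 𝓕 → Disjoint F _ → ¬ Monochromatic colour F
    bichromatic F∈𝓕 F∩Y≡∅ monochromatic
      with (x , x∈F∩R) , F⊈R ← straddles F∈𝓕 F∩Y≡∅
      with x∈F , x∈R ← x∈p∩q⁻ _ R x∈F∩R
      with y , y∈F , y∉R ← ⊈⇒∃∉ F⊈R
      = ∈-colour-separates R x∈R y∉R (monochromatic x∈F y∈F)

  constant⇒cd₂≤1 : (∀ {A} → A ∈F 𝓕 → Nonempty A) → (∀ {C D} → C ∈F 𝓕 → D ∈F 𝓕 → C ≡ D) →
    cd₂≤ 𝓕 1
  constant⇒cd₂≤1 nonempty constant
    with Z , ∣Z∣≤1 , Z⊆⋃𝓕 , hits ← unique⇒hitting-set≤1 {P = λ _ → ⊤} (λ _ → yes tt) nonempty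
                                     (λ C∈𝓕 D∈𝓕 _ _ → constant C∈𝓕 D∈𝓕)
    = Z , ∣Z∣≤1 , straddling⇒DefectWitness ⊥ Z⊆⋃𝓕 (λ F∈𝓕 F∩Z≡∅ → ⊥-elim (F∩Z≡∅ (hits F∈𝓕 tt)))

  constant-or-separated : (∀ {C D} → C ∈F 𝓕 → D ∈F 𝓕 → C ≡ D) ⊎ Separated
  constant-or-separated with any? (λ C → any? (λ D → ¬? (C ≟ D)) 𝓕) 𝓕
  ... | no ¬∃≢ = inj₁ λ C∈𝓕 D∈𝓕 → decidable-stable (_ ≟ _) (λ C≢D → ¬∃≢ (lose C∈𝓕 (lose D∈𝓕 C≢D)))
  ... | yes ∃≢
    with C , C∈𝓕 , ∃D≢C ← find ∃≢
    with D , D∈𝓕 , C≢D ← find ∃D≢C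
    with s , _ ← separate C∈𝓕 D∈𝓕 (C≢D ∘ sym)
    = inj₂ s

  pinned⇒cd₂≤3 : (∀ {A} → A ∈F 𝓕 → Nonempty A) →
    (∀ {A B} → A ∈F 𝓕 → B ∈F 𝓕 → A ≢ B →
      ∀ {C D} → C ∈F 𝓕 → D ∈F 𝓕 →
      Disjoint C A → Disjoint C B → Disjoint D A → Disjoint D B → C ≡ D) →
    Σ Separated Pinned → cd₂≤ 𝓕 3
  pinned⇒cd₂≤3 nonempty at-most-one (separated A B p A∈𝓕 B∈𝓕 p∈B p∉A , pinned)
    with q , q∈A ← nonempty A∈𝓕
    with Z , ∣Z∣≤1 , Z⊆⋃𝓕 , hits ← unique⇒hitting-set≤1
           (λ F → ¬? (nonempty? (F ∩ A)) ×-dec ¬? (nonempty? (F ∩ B))) nonempty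
           (λ C∈𝓕 D∈𝓕 (C∩A≡∅ , C∩B≡∅) (D∩A≡∅ , D∩B≡∅) →
              at-most-one A∈𝓕 B∈𝓕 (λ { refl → p∉A p∈B }) C∈𝓕 D∈𝓕 C∩A≡∅ C∩B≡∅ D∩A≡∅ D∩B≡∅)
    = Y , ∣Y∣≤3 , straddling⇒DefectWitness (A ∪ B) Y⊆⋃𝓕 straddles
    where
    Y : Subset n
    Y = (⁅ p ⁆ ∪ ⁅ q ⁆) ∪ Z

    ∣Y∣≤3 : ∣ Y ∣ ≤ 3
    ∣Y∣≤3 = ≤-trans (∣p∪q∣≤∣p∣+∣q∣ (⁅ p ⁆ ∪ ⁅ q ⁆) Z)
              (+-mono-≤ (≤-trans (∣p∪q∣≤∣p∣+∣q∣ ⁅ p ⁆ ⁅ q ⁆)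
                                 (+-mono-≤ (≤-reflexive (∣⁅x⁆∣≡1 p)) (≤-reflexive (∣⁅x⁆∣≡1 q))))
                        ∣Z∣≤1)

    Y⊆⋃𝓕 : Y ⊆ ⋃ 𝓕
    Y⊆⋃𝓕 = ∪-lub (∪-lub (⁅x⁆⊆p (∈F⇒⊆⋃ B∈𝓕 p∈B)) (⁅x⁆⊆p (∈F⇒⊆⋃ A∈𝓕 q∈A))) Z⊆⋃𝓕

    straddles : ∀ {F} → F ∈F 𝓕 → Disjoint F Y → Straddles (A ∪ B) F
    straddles {F} F∈𝓕 F∩Y≡∅ = meets , escapes
      where
      meets : Nonempty (F ∩ (A ∪ B))
      meets with nonempty? (F ∩ (A ∪ B))
      ... | yes F∩[A∪B]≢∅ = F∩[A∪B]≢∅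
      ... | no F∩[A∪B]≡∅ = ⊥-elim (disjoint-antimonoʳ (q⊆p∪q _ Z) F∩Y≡∅
              (hits F∈𝓕 (disjoint-antimonoʳ (p⊆p∪q B) F∩[A∪B]≡∅ ,
                         disjoint-antimonoʳ (q⊆p∪q A B) F∩[A∪B]≡∅)))

      escapes : F ⊈ A ∪ B
      escapes F⊆A∪B with F ≟ A
      ... | yes refl = disjoint⇒∉ F∩Y≡∅ q∈A (p⊆p∪q Z (q⊆p∪q ⁅ p ⁆ ⁅ q ⁆ (x∈⁅x⁆ q)))
      ... | no F≢A = disjoint⇒∉ F∩Y≡∅ (pinned F∈𝓕 F≢A F⊆A∪B) (p⊆p∪q Z (p⊆p∪q ⁅ q ⁆ (x∈⁅x⁆ p)))

corollary1 : ∀ (n : ℕ) (𝓕 : Family n) →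
    (∀ {A} → A ∈F 𝓕 → Nonempty A) →
    (∀ {A B} → A ∈F 𝓕 → B ∈F 𝓕 → A ≢ B →
      ∀ {C D} → C ∈F 𝓕 → D ∈F 𝓕 →
      Disjoint C A → Disjoint C B → Disjoint D A → Disjoint D B → C ≡ D) →
    cd₂≤ 𝓕 3
corollary1 n 𝓕 nonempty at-most-one with constant-or-separated 𝓕
... | inj₁ constant = cd₂≤-mono (s≤s z≤n) (constant⇒cd₂≤1 𝓕 nonempty constant)
... | inj₂ s = pinned⇒cd₂≤3 𝓕 nonempty at-most-one (pinned-separated 𝓕 s)
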